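{- Let $G$ be a graph. If $G$ has a dominating set of vertices inducing $K_1$ or $K_3$, then $G$ has no proper perfect edge dominating set.
   Context: Graphs are finite, simple and undirected. An edge dominates itself and every edge sharing an endpoint with it. A set $P\subseteq E(G)$ is a perfect edge dominating set if every edge of $E(G)\setminus P$ is dominated by exactly one edge of $P$, and an efficient edge dominating set if every edge of $E(G)$ is dominated by exactly one edge of $P$. $E(G)$ is the trivial perfect edge dominating set; a perfect edge dominating set is proper if it is neither trivial nor efficient. A set $X$ of vertices is dominating if every vertex outside $X$ has a neighbour in $X$. -}

module Defs where

open import Data.Nat using (ℕ)
open import Data.Fin using (Fin)
open import Data.Bool using (Bool; true; false)
open import Data.Product using (Σ; ∃; _×_; _,_)
open import Data.Sum using (_⊎_)
open import Relation.Binary.PropositionalEquality using (_≡_)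
open import Relation.Nullary using (¬_)

record Graph (n : ℕ) : Set where
  field
    adj     : Fin n → Fin n → Bool
    symm    : ∀ u v → adj u v ≡ adj v u
    irrefl  : ∀ v → adj v v ≡ false
open Graph public

module _ {n : ℕ} (G : Graph n) where

  Adj : Fin n → Fin n → Set
  Adj u v = adj G u v ≡ true

  record EdgeSet : Set where
    field
      mem    : Fin n → Fin n → Bool
      msymm  : ∀ u v → mem u v ≡ mem v u
      sub    : ∀ u v → mem u v ≡ true → Adj u v
  open EdgeSet public

  SameEdge : (Fin n × Fin n) → (Fin n × Fin n) → Set
  SameEdge (a , b) (c , d) = (a ≡ c × b ≡ d) ⊎ (a ≡ d × b ≡ c)

  -- edge {a,b} dominates edge {c,d}: they share an endpoint
  -- (in particular every edge dominates itself)
  Dominates : (Fin n × Fin n) → (Fin n × Fin n) → Set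
  Dominates (a , b) (c , d) = a ≡ c ⊎ a ≡ d ⊎ b ≡ c ⊎ b ≡ d

  InE : EdgeSet → (Fin n × Fin n) → Set
  InE P (u , v) = mem P u v ≡ true

  DominatedExactlyOnce : EdgeSet → (Fin n × Fin n) → Set
  DominatedExactlyOnce P f =
    Σ (Fin n × Fin n) (λ e → InE P e × Dominates e f)
    × (∀ e e′ → InE P e → Dominates e f → InE P e′ → Dominates e′ f → SameEdge e e′)

  IsPerfectEDS : EdgeSet → Set
  IsPerfectEDS P = ∀ u v → Adj u v → mem P u v ≡ false → DominatedExactlyOnce P (u , v)

  IsEfficientEDS : EdgeSet → Set
  IsEfficientEDS P = ∀ u v → Adj u v → DominatedExactlyOnce P (u , v)

  IsTrivial : EdgeSet → Set
  IsTrivial P = ∀ u v → mem P u v ≡ adj G u v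

  IsProperPerfectEDS : EdgeSet → Set
  IsProperPerfectEDS P = IsPerfectEDS P × ¬ IsTrivial P × ¬ IsEfficientEDS P

  IsDominating : (Fin n → Set) → Set
  IsDominating X = ∀ w → ¬ X w → Σ (Fin n) (λ x → X x × Adj w x)

  HasDominatingK1 : Set
  HasDominatingK1 = Σ (Fin n) (λ v → IsDominating (λ w → w ≡ v))

  HasDominatingK3 : Set
  HasDominatingK3 =
    Σ (Fin n) λ a → Σ (Fin n) λ b → Σ (Fin n) λ c →
      Adj a b × Adj b c × Adj a c
      × IsDominating (λ w → w ≡ a ⊎ w ≡ b ⊎ w ≡ c)

-- An edge uw ∉ P is dominated by exactly one edge of the perfect edge
-- dominating set P, so exactly one of u, w is covered by P, and that endpoint
-- has a single P-partner.  Hence P = E(G) if every vertex is covered, and P is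
-- efficient if it is a matching; so it suffices, given an uncovered vertex y
-- and a dominating K₁ or K₃, to show that no vertex is branching, i.e. has
-- two P-partners.
-- The key fact: if x has exactly one P-partner z, every other neighbour of x
-- is uncovered.  Near y the dominating clique has no branching vertex (in a
-- triangle this spreads from one corner to all).  A branching z is then
-- P-matched to some x of the clique, which leaves uncovered either z's second
-- partner (K₁) or the two other corners of the triangle, although they are
-- adjacent (K₃).
module Submission where

open import Defs
open import Data.Nat using (ℕ)
open import Data.Fin using (Fin; _≟_)
open import Data.Bool using (true; false)
open import Data.Product using (∃; ∃₂; _×_; _,_)
open import Data.Sum using (_⊎_; inj₁; inj₂; [_,_])
open import Data.Empty using (⊥; ⊥-elim)
open import Relation.Nullary using (¬_; yes; no)
open import Relation.Nullary.Decidable using (_⊎-dec_)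
open import Relation.Unary using (Decidable)
open import Relation.Binary.PropositionalEquality using (_≡_; _≢_; refl; sym; trans)

_∈N[_,_] : ∀ {n} → Fin n → Graph n → Fin n → Set
w ∈N[ G , x ] = w ≡ x ⊎ Adj G w x

module _ {n : ℕ} (G : Graph n) where

  adj-irrefl : ∀ {u} → ¬ Adj G u u
  adj-irrefl {u} uu with () ← trans (sym uu) (irrefl G u)

  adj-sym : ∀ {u v} → Adj G u v → Adj G v u
  adj-sym {u} {v} uv = trans (symm G v u) uv

  adj⇒≢ : ∀ {u v} → Adj G u v → u ≢ v
  adj⇒≢ uv refl = adj-irrefl uv

  dominated : ∀ {X : Fin n → Set} → Decidable X → IsDominating G X →
              ∀ w → ∃ λ x → X x × w ∈N[ G , x ]
  dominated X? dom w with X? w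
  ... | yes Xw = w , Xw , inj₁ refl
  ... | no ¬Xw with dom w ¬Xw
  ...   | x , Xx , wx = x , Xx , inj₂ wx

  SameEdge-sym : ∀ {e e′} → SameEdge G e e′ → SameEdge G e′ e
  SameEdge-sym (inj₁ (refl , refl)) = inj₁ (refl , refl)
  SameEdge-sym (inj₂ (refl , refl)) = inj₂ (refl , refl)

  SameEdge-trans : ∀ {e e′ e″} → SameEdge G e e′ → SameEdge G e′ e″ → SameEdge G e e″
  SameEdge-trans (inj₁ (refl , refl)) same = same
  SameEdge-trans (inj₂ (refl , refl)) (inj₁ (refl , refl)) = inj₂ (refl , refl)
  SameEdge-trans (inj₂ (refl , refl)) (inj₂ (refl , refl)) = inj₁ (refl , refl)

  Triangle : Fin n → Fin n → Fin n → Set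
  Triangle a b c = Adj G a b × Adj G b c × Adj G c a

  rotate : ∀ {a b c} → Triangle a b c → Triangle b c a
  rotate (ab , bc , ca) = bc , ca , ab

module _ {n : ℕ} {G : Graph n} (P : EdgeSet G) where

  Covered : Fin n → Set
  Covered w = ∃ λ u → mem P w u ≡ true

  Branching : Fin n → Set
  Branching z = ∃₂ λ p q → mem P z p ≡ true × mem P z q ≡ true × p ≢ q

  IsMatching : Set
  IsMatching = ∀ z → ¬ Branching z

module EdgeSetProperties {n : ℕ} {G : Graph n} (P : EdgeSet G) where

  mem-sym : ∀ {u v} → mem P u v ≡ true → mem P v u ≡ true
  mem-sym {u} {v} uv = trans (msymm P v u) uv

  mem⇒≢ : ∀ {u v} → mem P u v ≡ true → u ≢ v
  mem⇒≢ {u} uv = adj⇒≢ G (sub P u _ uv)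

  branching⇒covered : ∀ {z} → Branching P z → Covered P z
  branching⇒covered (p , _ , zp , _) = p , zp

  branching⇒partner-≢ : ∀ {z} → Branching P z → ∀ v → ∃ λ r → mem P z r ≡ true × r ≢ v
  branching⇒partner-≢ (p , q , zp , zq , p≢q) v with p ≟ v
  ... | yes refl = q , zq , λ q≡p → p≢q (sym q≡p)
  ... | no p≢v = p , zp , p≢v

  module _ (matching : IsMatching P) where

    partner-unique : ∀ {x p q} → mem P x p ≡ true → mem P x q ≡ true → p ≡ q
    partner-unique {x} {p} {q} xp xq with p ≟ q
    ... | yes p≡q = p≡q
    ... | no p≢q = ⊥-elim (matching x (p , q , xp , xq , p≢q))

    P-edge-dominating-P-edge : ∀ {u v} e → InE G P e → Dominates G e (u , v) →
                               mem P u v ≡ true → SameEdge G e (u , v)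
    P-edge-dominating-P-edge (_ , b) ab (inj₁ refl) uv =
      inj₁ (refl , partner-unique ab uv)
    P-edge-dominating-P-edge (_ , b) ab (inj₂ (inj₁ refl)) uv =
      inj₂ (refl , partner-unique ab (mem-sym uv))
    P-edge-dominating-P-edge (a , _) ab (inj₂ (inj₂ (inj₁ refl))) uv =
      inj₂ (partner-unique (mem-sym ab) uv , refl)
    P-edge-dominating-P-edge (a , _) ab (inj₂ (inj₂ (inj₂ refl))) uv =
      inj₁ (partner-unique (mem-sym ab) (mem-sym uv) , refl)

module PerfectEDS {n : ℕ} {G : Graph n} {P : EdgeSet G} (perfect : IsPerfectEDS G P) where

  open EdgeSetProperties P

  private
    M = mem P

  unique-dominator : ∀ {u w} → Adj G u w → M u w ≡ false →
                     ∀ e e′ → InE G P e → Dominates G e (u , w) →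
                     InE G P e′ → Dominates G e′ (u , w) → SameEdge G e e′
  unique-dominator uw uw∉P with perfect _ _ uw uw∉P
  ... | _ , unique = unique

  nonedge-end-covered : ∀ {u w} → Adj G u w → M u w ≡ false → Covered P u ⊎ Covered P w
  nonedge-end-covered uw uw∉P with perfect _ _ uw uw∉P
  ... | ((x , y) , xy , inj₁ refl) , _ = inj₁ (y , xy)
  ... | ((x , y) , xy , inj₂ (inj₁ refl)) , _ = inj₂ (y , xy)
  ... | ((x , y) , xy , inj₂ (inj₂ (inj₁ refl))) , _ = inj₁ (x , mem-sym xy)
  ... | ((x , y) , xy , inj₂ (inj₂ (inj₂ refl))) , _ = inj₂ (x , mem-sym xy)

  edge-end-covered : ∀ {u w} → Adj G u w → Covered P u ⊎ Covered P w
  edge-end-covered {u} {w} uw with M u w in uw∈P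
  ... | true = inj₁ (w , uw∈P)
  ... | false = nonedge-end-covered uw uw∈P

  nonedge-ends-not-both-covered : ∀ {u w} → Adj G u w → M u w ≡ false →
                                  Covered P u → Covered P w → ⊥
  nonedge-ends-not-both-covered uw uw∉P (s , us) (t , wt)
    with unique-dominator uw uw∉P (_ , s) (_ , t) us (inj₁ refl) wt (inj₂ (inj₁ refl))
  ... | inj₁ (refl , _) = adj-irrefl G uw
  ... | inj₂ (refl , refl) with () ← trans (sym us) uw∉P

  nonedge-end-not-branching : ∀ {u w} → Adj G u w → M u w ≡ false → ¬ Branching P u
  nonedge-end-not-branching uw uw∉P (p , q , up , uq , p≢q)
    with unique-dominator uw uw∉P (_ , p) (_ , q) up (inj₁ refl) uq (inj₁ refl)
  ... | inj₁ (_ , p≡q) = p≢q p≡q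
  ... | inj₂ (refl , refl) = mem⇒≢ up refl

  branching-edge∈P : ∀ {z x} → Branching P z → Adj G z x → M z x ≡ true
  branching-edge∈P {z} {x} zB zx with M z x in zx∈P
  ... | true = refl
  ... | false = ⊥-elim (nonedge-end-not-branching zx zx∈P zB)

  uncovered-near⇒unbranched : ∀ {y x} → ¬ Covered P y → y ∈N[ G , x ] → ¬ Branching P x
  uncovered-near⇒unbranched y∉ (inj₁ refl) yB = y∉ (branching⇒covered yB)
  uncovered-near⇒unbranched y∉ (inj₂ yx) xB = y∉ (_ , mem-sym (branching-edge∈P xB (adj-sym G yx)))

  unbranched-neighbours-uncovered : ∀ {x z w} → ¬ Branching P x → M x z ≡ true →
                                    Adj G x w → w ≢ z → ¬ Covered P w
  unbranched-neighbours-uncovered {x} {z} {w} ¬xB xz xw w≢z w-covered with M x w in xw∈P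
  ... | true = ¬xB (z , w , xz , xw∈P , λ z≡w → w≢z (sym z≡w))
  ... | false = nonedge-ends-not-both-covered xw xw∈P (z , xz) w-covered

  covering⇒trivial : (∀ y → ¬ ¬ Covered P y) → IsTrivial G P
  covering⇒trivial covering u w with M u w in uw∈P
  ... | true = sym (sub P u w uw∈P)
  ... | false with adj G u w in uw
  ...   | false = refl
  ...   | true with nonedge-end-covered uw uw∈P
  ...     | inj₁ u-cov = ⊥-elim (covering w (nonedge-ends-not-both-covered uw uw∈P u-cov))
  ...     | inj₂ w-cov = ⊥-elim (covering u λ u-cov → nonedge-ends-not-both-covered uw uw∈P u-cov w-cov)

  module _ (matching : IsMatching P) where

    matching⇒efficient : IsEfficientEDS G P
    matching⇒efficient u v uv with M u v in uv∈P
    ... | false = perfect u v uv uv∈P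
    ... | true = ((u , v) , uv∈P , inj₁ refl) , λ e e′ e∈P e-dom e′∈P e′-dom →
      SameEdge-trans G (P-edge-dominating-P-edge matching e e∈P e-dom uv∈P)
                     (SameEdge-sym G (P-edge-dominating-P-edge matching e′ e′∈P e′-dom uv∈P))

  dominating-vertex⇒matching : ∀ {v y} → IsDominating G (_≡ v) → ¬ Covered P y → IsMatching P
  dominating-vertex⇒matching {v} {y} dom y∉ z zB with dominated G (_≟ v) dom y
  ... | _ , refl , yv with dominated G (_≟ v) dom z
  ...   | _ , refl , inj₁ refl = uncovered-near⇒unbranched y∉ yv zB
  ...   | _ , refl , inj₂ zv with branching⇒partner-≢ zB v
  ...     | r , zr , r≢v with dominated G (_≟ v) dom r
  ...       | _ , refl , inj₁ r≡v = r≢v r≡v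
  ...       | _ , refl , inj₂ rv =
    unbranched-neighbours-uncovered (uncovered-near⇒unbranched y∉ yv)
      (mem-sym (branching-edge∈P zB zv)) (adj-sym G rv) (mem⇒≢ (mem-sym zr)) (z , mem-sym zr)

  triangle-unbranched-next : ∀ {a b c} → Triangle G a b c → ¬ Branching P a → ¬ Branching P b
  triangle-unbranched-next (ab , bc , ca) ¬aB bB =
    unbranched-neighbours-uncovered ¬aB (mem-sym (branching-edge∈P bB (adj-sym G ab)))
      (adj-sym G ca) (adj⇒≢ G (adj-sym G bc)) (_ , mem-sym (branching-edge∈P bB bc))

  triangle-unbranched : ∀ {a b c} → Triangle G a b c → ¬ Branching P a →
                        ¬ Branching P a × ¬ Branching P b × ¬ Branching P c
  triangle-unbranched abc ¬aB = ¬aB , ¬bB , triangle-unbranched-next (rotate G abc) ¬bB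
    where ¬bB = triangle-unbranched-next abc ¬aB

  near-unbranched-triangle⇒unbranched : ∀ {x s t z} → Triangle G x s t →
    ¬ Branching P x × ¬ Branching P s × ¬ Branching P t → z ∈N[ G , x ] → ¬ Branching P z
  near-unbranched-triangle⇒unbranched _ (¬xB , _) (inj₁ refl) zB = ¬xB zB
  near-unbranched-triangle⇒unbranched {x} {s} {t} {z} (xs , st , tx) (¬xB , ¬sB , ¬tB) (inj₂ zx) zB =
    [ s-uncovered , t-uncovered ] (edge-end-covered st)
    where
    xz : M x z ≡ true
    xz = mem-sym (branching-edge∈P zB zx)
    s-uncovered : ¬ Covered P s
    s-uncovered = unbranched-neighbours-uncovered ¬xB xz xs λ { refl → ¬sB zB }
    t-uncovered : ¬ Covered P t
    t-uncovered = unbranched-neighbours-uncovered ¬xB xz (adj-sym G tx) λ { refl → ¬tB zB }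

  triangle-unbranched-at : ∀ {a b c x} → Triangle G a b c → x ≡ a ⊎ x ≡ b ⊎ x ≡ c → ¬ Branching P x →
                           ¬ Branching P a × ¬ Branching P b × ¬ Branching P c
  triangle-unbranched-at abc (inj₁ refl) ¬aB = triangle-unbranched abc ¬aB
  triangle-unbranched-at abc (inj₂ (inj₁ refl)) ¬bB with triangle-unbranched (rotate G abc) ¬bB
  ... | ¬bB′ , ¬cB , ¬aB = ¬aB , ¬bB′ , ¬cB
  triangle-unbranched-at abc (inj₂ (inj₂ refl)) ¬cB with triangle-unbranched (rotate G (rotate G abc)) ¬cB
  ... | ¬cB′ , ¬aB , ¬bB = ¬aB , ¬bB , ¬cB′

  near-unbranched-triangle-at⇒unbranched : ∀ {a b c x z} → Triangle G a b c →
    ¬ Branching P a × ¬ Branching P b × ¬ Branching P c →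
    x ≡ a ⊎ x ≡ b ⊎ x ≡ c → z ∈N[ G , x ] → ¬ Branching P z
  near-unbranched-triangle-at⇒unbranched abc unbranched (inj₁ refl) =
    near-unbranched-triangle⇒unbranched abc unbranched
  near-unbranched-triangle-at⇒unbranched abc (¬aB , ¬bB , ¬cB) (inj₂ (inj₁ refl)) =
    near-unbranched-triangle⇒unbranched (rotate G abc) (¬bB , ¬cB , ¬aB)
  near-unbranched-triangle-at⇒unbranched abc (¬aB , ¬bB , ¬cB) (inj₂ (inj₂ refl)) =
    near-unbranched-triangle⇒unbranched (rotate G (rotate G abc)) (¬cB , ¬aB , ¬bB)

  dominating-triangle⇒matching : ∀ {a b c y} → Triangle G a b c →
    IsDominating G (λ w → w ≡ a ⊎ w ≡ b ⊎ w ≡ c) → ¬ Covered P y → IsMatching P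
  dominating-triangle⇒matching {a} {b} {c} abc dom y∉ z
    with dominated G abc? dom _ | dominated G abc? dom z
    where abc? = λ w → w ≟ a ⊎-dec w ≟ b ⊎-dec w ≟ c
  ... | _ , x∈abc , yx | _ , x′∈abc , zx′ =
    near-unbranched-triangle-at⇒unbranched abc
      (triangle-unbranched-at abc x∈abc (uncovered-near⇒unbranched y∉ yx)) x′∈abc zx′

corollary22 : (n : ℕ) (G : Graph n) →
    HasDominatingK1 G ⊎ HasDominatingK3 G →
    (P : EdgeSet G) → ¬ IsProperPerfectEDS G P
corollary22 n G dominating P (perfect , nontrivial , inefficient) =
  nontrivial (covering⇒trivial λ y y∉ → inefficient (matching⇒efficient (matching dominating y∉)))
  where
  open PerfectEDS {G = G} {P = P} perfect

  matching : ∀ {y} → HasDominatingK1 G ⊎ HasDominatingK3 G → ¬ Covered P y → IsMatching P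
  matching (inj₁ (_ , dom)) = dominating-vertex⇒matching dom
  matching (inj₂ (_ , _ , _ , ab , bc , ac , dom)) =
    dominating-triangle⇒matching (ab , bc , adj-sym G ac) dom
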